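{- Suppose that $\sqrt{p_m} - \sqrt{p_{m-1}} < \frac{1}{2}$ holds for every integer $m \geq 32$. Then for every integer $n \geq 2$ the open interval $(n, 2n)$ contains at least $\left[\frac{1}{2}\sqrt{2n}\right]$ prime numbers.
   Context: $p_m$ denotes the $m$-th prime number ($p_1 = 2$). $[x]$ denotes the integer part (floor) of $x$. -}

module Defs where

open import Data.Nat using (ℕ; suc; _+_; _*_; _∸_)
open import Data.Nat.Primality using (Prime; prime?)
open import Data.List using (List; length; filter; upTo; applyUpTo)
open import Data.Product using (_×_)
open import Relation.Binary.PropositionalEquality using (_≡_)

primeCount : ℕ → ℕ
primeCount x = length (filter prime? (upTo (suc x)))

-- p is the m-th prime (p_1 = 2): p is prime and exactly m primes are ≤ p
IsNthPrime : ℕ → ℕ → Set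
IsNthPrime m p = Prime p × primeCount p ≡ m

-- the list n+1, n+2, ..., 2n-1 (integers in the open interval (n, 2n))
openInterval : ℕ → List ℕ
openInterval n = applyUpTo (λ i → suc n + i) (n ∸ 1)

primesBetween : ℕ → ℕ
primesBetween n = length (filter prime? (openInterval n))

{-# OPTIONS --safe #-}
-- For n ≥ 127 we have π(n) ≥ 31, so the
-- hypothesis governs every prime after the largest prime q ≤ n: passing to the next prime raises
-- 4√p by less than 2. Starting from 4√q < Y := ⌊4√n⌋ + 1, the k-th prime after q is therefore
-- below (Y + 2k)²/16, and AM–GM with 2k² ≤ n gives (Y + 2k)² ≤ 32n, so these k primes lie in
-- (n, 2n). For 2 ≤ n ≤ 126 the claim is checked by computation, on blocks [a, b] of values of n
-- that all contain the primes of (b, 2a).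
module Submission where

open import Defs
open import Data.Nat
  using (ℕ; zero; suc; _+_; _*_; _∸_; _^_; _!; _≤_; _<_; z≤n; s≤s; s≤s⁻¹; _≤′_; ≤′-refl; ≤′-step; NonZero)
open import Data.Nat.Properties
open import Algebra.Properties.CommutativeSemigroup +-commutativeSemigroup using (xy∙z≈xz∙y)
open import Data.Nat.Divisibility using (_∣_; divides; ∣-trans; m∣m*n; ∣m+n∣m⇒∣n; ∣1⇒≡1; m≤n⇒m!∣n!)
open import Data.Nat.Primality using (Prime; prime?; ¬prime[1]; prime⇒nonZero)
open import Data.Nat.Primality.Factorisation using (factorise)
open import Data.Nat.ListAction using (product)
open import Data.Nat.Tactic.RingSolver using (solve-∀)
open import Data.List using (List; []; _∷_; _++_; [_]; length; filter; upTo; applyUpTo)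
open import Data.List.Properties using (length-++; filter-++; filter-accept; filter-reject; upTo-∷ʳ; applyUpTo-∷ʳ)
open import Data.List.Relation.Unary.All using (_∷_)
open import Data.Product using (∃-syntax; _×_; _,_)
open import Data.Sum using ([_,_]′)
open import Relation.Nullary using (¬_; yes; no; Dec; contradiction)
open import Relation.Nullary.Decidable using (from-yes; _×-dec_)
open import Relation.Binary.PropositionalEquality
  using (_≡_; _≢_; sym; trans; cong; subst; subst₂; module ≡-Reasoning)

countPrimes : List ℕ → ℕ
countPrimes xs = length (filter prime? xs)

countPrimes-++ : ∀ xs ys → countPrimes (xs ++ ys) ≡ countPrimes xs + countPrimes ys
countPrimes-++ xs ys = trans (cong length (filter-++ prime? xs ys)) (length-++ (filter prime? xs))

primeCount-suc : ∀ x → primeCount (suc x) ≡ primeCount x + countPrimes [ suc x ]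
primeCount-suc x = trans (cong countPrimes (sym (upTo-∷ʳ (suc x)))) (countPrimes-++ (upTo (suc x)) [ suc x ])

primeCount-suc-prime : ∀ {x} → Prime (suc x) → primeCount (suc x) ≡ suc (primeCount x)
primeCount-suc-prime {x} p = begin
  primeCount (suc x)                  ≡⟨ primeCount-suc x ⟩
  primeCount x + countPrimes [ suc x ] ≡⟨ cong (λ ps → primeCount x + length ps) (filter-accept prime? p) ⟩
  primeCount x + 1                    ≡⟨ +-comm (primeCount x) 1 ⟩
  suc (primeCount x)                  ∎
  where open ≡-Reasoning

primeCount-suc-¬prime : ∀ {x} → ¬ Prime (suc x) → primeCount (suc x) ≡ primeCount x
primeCount-suc-¬prime {x} ¬p = begin
  primeCount (suc x)                  ≡⟨ primeCount-suc x ⟩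
  primeCount x + countPrimes [ suc x ] ≡⟨ cong (λ ps → primeCount x + length ps) (filter-reject prime? ¬p) ⟩
  primeCount x + 0                    ≡⟨ +-identityʳ (primeCount x) ⟩
  primeCount x                        ∎
  where open ≡-Reasoning

primeCount-suc-≤ : ∀ x → primeCount (suc x) ≤ suc (primeCount x)
primeCount-suc-≤ x with prime? (suc x)
... | yes p = ≤-reflexive (primeCount-suc-prime p)
... | no ¬p = ≤-trans (≤-reflexive (primeCount-suc-¬prime ¬p)) (n≤1+n (primeCount x))

primeCount-≤-suc : ∀ x → primeCount x ≤ primeCount (suc x)
primeCount-≤-suc x = ≤-trans (m≤m+n (primeCount x) _) (≤-reflexive (sym (primeCount-suc x)))

primeCount-mono : ∀ {x y} → x ≤ y → primeCount x ≤ primeCount y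
primeCount-mono x≤y = go (≤⇒≤′ x≤y)
  where
  go : ∀ {x y} → x ≤′ y → primeCount x ≤ primeCount y
  go ≤′-refl                    = ≤-refl
  go {y = suc y} (≤′-step x≤′y) = ≤-trans (go x≤′y) (primeCount-≤-suc y)

primeCount-attains : ∀ {m} x → 1 ≤ m → m ≤ primeCount x → ∃[ p ] p ≤ x × IsNthPrime m p
primeCount-attains zero    1≤m m≤0 = contradiction (≤-trans 1≤m m≤0) λ ()
primeCount-attains {m} (suc x) 1≤m m≤π with m ≤? primeCount x
... | yes m≤π′ = let p , p≤x , isP = primeCount-attains x 1≤m m≤π′ in p , m≤n⇒m≤1+n p≤x , isP
... | no  m≰π′ with prime? (suc x)
...   | yes p = suc x , ≤-refl , p , ≤-antisym (≤-trans (primeCount-suc-≤ x) (≰⇒> m≰π′)) m≤π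
...   | no ¬p = contradiction (subst (m ≤_) (primeCount-suc-¬prime ¬p) m≤π) m≰π′

∃-prime-∣ : ∀ n .{{_ : NonZero n}} → n ≢ 1 → ∃[ p ] Prime p × p ∣ n
∃-prime-∣ n n≢1 with factorise n
... | record { factors = [] ; isFactorisation = n≡1 } = contradiction n≡1 n≢1
... | record { factors = p ∷ ps ; isFactorisation = n≡p*Πps ; factorsPrime = prime-p ∷ _ } =
  p , prime-p , divides (product ps) (trans n≡p*Πps (*-comm p (product ps)))

m≤n⇒m∣n! : ∀ {m n} .{{_ : NonZero m}} → m ≤ n → m ∣ n !
m≤n⇒m∣n! {suc m} m≤n = ∣-trans (m∣m*n (m !)) (m≤n⇒m!∣n! m≤n)

∃-prime-> : ∀ N → ∃[ p ] N < p × Prime p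
∃-prime-> N =
  let p , prime-p , p∣N!+1 = ∃-prime-∣ (suc (N !)) (λ eq → <⇒≱ (1≤n! N) (≤-reflexive (suc-injective eq)))
  in p , ≰⇒> (p≰N prime-p (subst (p ∣_) (+-comm 1 (N !)) p∣N!+1)) , prime-p
  where
  p≰N : ∀ {p} → Prime p → p ∣ N ! + 1 → ¬ p ≤ N
  p≰N prime-p p∣N!+1 p≤N =
    ¬prime[1] (subst Prime (∣1⇒≡1 (∣m+n∣m⇒∣n p∣N!+1 (m≤n⇒m∣n! {{prime⇒nonZero prime-p}} p≤N))) prime-p)

primeCount-unbounded : ∀ m → ∃[ x ] m ≤ primeCount x
primeCount-unbounded zero    = 0 , z≤n
primeCount-unbounded (suc m) with primeCount-unbounded m
... | x , m≤πx with ∃-prime-> x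
...   | suc r , x<r , prime-r =
  suc r , subst (suc m ≤_) (sym (primeCount-suc-prime prime-r)) (s≤s (≤-trans m≤πx (primeCount-mono (s≤s⁻¹ x<r))))

∃-nthPrime : ∀ m → ∃[ p ] IsNthPrime (suc m) p
∃-nthPrime m =
  let x , m<πx = primeCount-unbounded (suc m)
      p , _ , isP = primeCount-attains x (s≤s z≤n) m<πx
  in p , isP

countPrimes-window : ∀ n d → countPrimes (applyUpTo (suc n +_) d) + primeCount n ≡ primeCount (n + d)
countPrimes-window n zero    = cong primeCount (sym (+-identityʳ n))
countPrimes-window n (suc d) = begin
  countPrimes (applyUpTo (suc n +_) (suc d)) + primeCount n
    ≡⟨ cong (λ xs → countPrimes xs + primeCount n) (sym (applyUpTo-∷ʳ (suc n +_) d)) ⟩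
  countPrimes (window ++ [ suc (n + d) ]) + primeCount n
    ≡⟨ cong (_+ primeCount n) (countPrimes-++ window [ suc (n + d) ]) ⟩
  countPrimes window + countPrimes [ suc (n + d) ] + primeCount n
    ≡⟨ xy∙z≈xz∙y (countPrimes window) _ (primeCount n) ⟩
  countPrimes window + primeCount n + countPrimes [ suc (n + d) ]
    ≡⟨ cong (_+ countPrimes [ suc (n + d) ]) (countPrimes-window n d) ⟩
  primeCount (n + d) + countPrimes [ suc (n + d) ]
    ≡⟨ sym (primeCount-suc (n + d)) ⟩
  primeCount (suc (n + d))
    ≡⟨ cong primeCount (sym (+-suc n d)) ⟩
  primeCount (n + suc d) ∎
  where
  open ≡-Reasoning
  window : List ℕ
  window = applyUpTo (suc n +_) d

primesBetween≡ : ∀ n → primesBetween n ≡ primeCount (n + (n ∸ 1)) ∸ primeCount n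
primesBetween≡ n = begin
  primesBetween n                                  ≡⟨ sym (m+n∸n≡m (primesBetween n) (primeCount n)) ⟩
  primesBetween n + primeCount n ∸ primeCount n    ≡⟨ cong (_∸ primeCount n) (countPrimes-window n (n ∸ 1)) ⟩
  primeCount (n + (n ∸ 1)) ∸ primeCount n          ∎
  where open ≡-Reasoning

m*m<n*n⇒m<n : ∀ {m n} → m * m < n * n → m < n
m*m<n*n⇒m<n m*m<n*n = ≰⇒> λ n≤m → <⇒≱ m*m<n*n (*-mono-≤ n≤m n≤m)

2mn≤m²+n² : ∀ m n → 2 * (m * n) ≤ m * m + n * n
2mn≤m²+n² m n = [ ordered , flipped ]′ (≤-total m n)
  where
  expand : ∀ m c → 2 * (m * (m + c)) + c * c ≡ m * m + (m + c) * (m + c)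
  expand = solve-∀
  ordered : ∀ {m n} → m ≤ n → 2 * (m * n) ≤ m * m + n * n
  ordered {m} {n} m≤n = subst (λ n → 2 * (m * n) ≤ m * m + n * n) (m+[n∸m]≡n m≤n)
    (≤-trans (m≤m+n _ ((n ∸ m) * (n ∸ m))) (≤-reflexive (expand m (n ∸ m))))
  flipped : n ≤ m → 2 * (m * n) ≤ m * m + n * n
  flipped n≤m = subst₂ _≤_ (cong (2 *_) (*-comm n m)) (+-comm (n * n) (m * m)) (ordered n≤m)

⌊√_⌋ : ∀ N → ∃[ t ] t * t ≤ N × N < suc t * suc t
⌊√ zero ⌋  = 0 , z≤n , s≤s z≤n
⌊√ suc N ⌋ with ⌊√ N ⌋
... | t , t²≤N , N<[t+1]² with suc N <? suc t * suc t
...   | yes N+1<[t+1]² = t , m≤n⇒m≤1+n t²≤N , N+1<[t+1]²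
...   | no  N+1≮[t+1]² =
  suc t , ≮⇒≥ N+1≮[t+1]² , ≤-<-trans N<[t+1]² (*-mono-< (n<1+n (suc t)) (n<1+n (suc t)))

-- √pₘ − √pₘ₋₁ < 1/2 for all m ≥ m₀, with both sides squared out as (4(pₘ − pₘ₋₁) − 1)² < 16 pₘ₋₁
SqrtGapsBelowHalf : ℕ → Set
SqrtGapsBelowHalf m₀ = (m p q : ℕ) → m₀ ≤ m → IsNthPrime m p → IsNthPrime (m ∸ 1) q →
  (4 * (p ∸ q) ∸ 1) ^ 2 < 16 * q

sqrtGapsBelowHalf-mono : ∀ {m₀ m₁} → m₀ ≤ m₁ → SqrtGapsBelowHalf m₀ → SqrtGapsBelowHalf m₁
sqrtGapsBelowHalf-mono m₀≤m₁ gaps m p q m₁≤m = gaps m p q (≤-trans m₀≤m₁ m₁≤m)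

-- With Y > 4√p, the gap hypothesis 4(p' − p) − 1 < 4√p yields 4(p' − p) ≤ Y, so 16p' < Y² + 4Y.
sqrt-gap-step : ∀ {p p′ Y} → (4 * (p′ ∸ p) ∸ 1) ^ 2 < 16 * p → 16 * p < Y * Y →
                16 * p′ < (Y + 2) * (Y + 2)
sqrt-gap-step {p} {p′} {Y} gap 16p<Y² = begin-strict
  16 * p′                    ≤⟨ *-monoʳ-≤ 16 (m≤n+m∸n p′ p) ⟩
  16 * (p + d)               ≡⟨ distrib p d ⟩
  16 * p + 4 * (4 * d)       <⟨ +-mono-<-≤ 16p<Y² (*-monoʳ-≤ 4 4d≤Y) ⟩
  Y * Y + 4 * Y              ≤⟨ m≤m+n (Y * Y + 4 * Y) 4 ⟩
  Y * Y + 4 * Y + 4          ≡⟨ square Y ⟩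
  (Y + 2) * (Y + 2)          ∎
  where
  open ≤-Reasoning
  d e : ℕ
  d = p′ ∸ p
  e = 4 * d ∸ 1
  e<Y : e < Y
  e<Y = m*m<n*n⇒m<n (<-trans (subst (_< 16 * p) (cong (e *_) (*-identityʳ e)) gap) 16p<Y²)
  4d≤Y : 4 * d ≤ Y
  4d≤Y = ≤-trans (m≤n+m∸n (4 * d) 1) e<Y
  distrib : ∀ p d → 16 * (p + d) ≡ 16 * p + 4 * (4 * d)
  distrib = solve-∀
  square : ∀ Y → Y * Y + 4 * Y + 4 ≡ (Y + 2) * (Y + 2)
  square = solve-∀

nthPrime-sqrt-growth : ∀ {m q Y} → SqrtGapsBelowHalf (suc m) → IsNthPrime m q → 16 * q < Y * Y →
  ∀ j → ∃[ p ] IsNthPrime (m + j) p × 16 * p < (Y + 2 * j) * (Y + 2 * j)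
nthPrime-sqrt-growth {m} {q} {Y} gaps isQ 16q<Y² zero =
  q , subst (λ i → IsNthPrime i q) (sym (+-identityʳ m)) isQ
    , subst (λ Z → 16 * q < Z * Z) (sym (+-identityʳ Y)) 16q<Y²
nthPrime-sqrt-growth {m} {q} {Y} gaps isQ 16q<Y² (suc j) with nthPrime-sqrt-growth {Y = Y} gaps isQ 16q<Y² j
... | p , isP , 16p<[Y+2j]² =
  let p′ , isP′ = ∃-nthPrime (m + j)
      gap = gaps (suc (m + j)) p′ p (s≤s (m≤m+n m j)) isP′ isP
  in p′ , subst (λ i → IsNthPrime i p′) (sym (+-suc m j)) isP′
        , subst (λ Z → 16 * p′ < Z * Z) (shift Y j) (sqrt-gap-step {p} {p′} {Y + 2 * j} gap 16p<[Y+2j]²)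
  where
  shift : ∀ Y j → Y + 2 * j + 2 ≡ Y + 2 * suc j
  shift = solve-∀

nthPrime<2n⇒≤primesBetween : ∀ {n k P} → IsNthPrime (primeCount n + k) P → P < 2 * n → k ≤ primesBetween n
nthPrime<2n⇒≤primesBetween {suc n} {k} {P} (_ , πP≡πn+k) P<2n = begin
  k                                           ≡⟨ sym (m+n∸m≡n (primeCount (suc n)) k) ⟩
  primeCount (suc n) + k ∸ primeCount (suc n) ≡⟨ cong (_∸ primeCount (suc n)) (sym πP≡πn+k) ⟩
  primeCount P ∸ primeCount (suc n)           ≤⟨ ∸-monoˡ-≤ (primeCount (suc n)) (primeCount-mono P≤2n-1) ⟩
  primeCount (suc n + n) ∸ primeCount (suc n) ≡⟨ sym (primesBetween≡ (suc n)) ⟩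
  primesBetween (suc n)                       ∎
  where
  open ≤-Reasoning
  double : ∀ n → 2 * suc n ≡ suc (suc n + n)
  double = solve-∀
  P≤2n-1 : P ≤ suc n + n
  P≤2n-1 = s≤s⁻¹ (subst (P <_) (double n) P<2n)

[t+2k]²≤30n : ∀ {n t k} → t * t ≤ 16 * n → 2 * (k * k) ≤ n → (t + 2 * k) * (t + 2 * k) ≤ 30 * n
[t+2k]²≤30n {n} {t} {k} t²≤16n 2k²≤n = *-cancelˡ-≤ 4 (begin
  4 * ((t + 2 * k) * (t + 2 * k))                        ≡⟨ expand t k ⟩
  4 * (t * t) + 2 * (t * (8 * k)) + 16 * (k * k)         ≤⟨ +-monoˡ-≤ (16 * (k * k)) (+-monoʳ-≤ (4 * (t * t)) amgm) ⟩
  4 * (t * t) + (t * t + 8 * k * (8 * k)) + 16 * (k * k) ≡⟨ regroup t k ⟩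
  5 * (t * t) + 40 * (2 * (k * k))                       ≤⟨ +-mono-≤ (*-monoʳ-≤ 5 t²≤16n) (*-monoʳ-≤ 40 2k²≤n) ⟩
  5 * (16 * n) + 40 * n                                  ≡⟨ collect n ⟩
  4 * (30 * n)                                           ∎)
  where
  open ≤-Reasoning
  expand : ∀ t k → 4 * ((t + 2 * k) * (t + 2 * k)) ≡ 4 * (t * t) + 2 * (t * (8 * k)) + 16 * (k * k)
  expand = solve-∀
  amgm : 2 * (t * (8 * k)) ≤ t * t + 8 * k * (8 * k)
  amgm = 2mn≤m²+n² t (8 * k)
  regroup : ∀ t k → 4 * (t * t) + (t * t + 8 * k * (8 * k)) + 16 * (k * k) ≡ 5 * (t * t) + 40 * (2 * (k * k))
  regroup = solve-∀
  collect : ∀ n → 5 * (16 * n) + 40 * n ≡ 4 * (30 * n)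
  collect = solve-∀

[s+1]²≤32n : ∀ {n s} → s * s ≤ 30 * n → 31 ≤ n → suc s * suc s ≤ 32 * n
[s+1]²≤32n {n} {s} s²≤30n 31≤n = begin
  suc s * suc s          ≡⟨ expand s ⟩
  s * s + (s + suc s)    ≤⟨ +-mono-≤ s²≤30n (+-mono-≤ (<⇒≤ s<n) s<n) ⟩
  30 * n + (n + n)       ≡⟨ collect n ⟩
  32 * n                 ∎
  where
  open ≤-Reasoning
  expand : ∀ s → suc s * suc s ≡ s * s + (s + suc s)
  expand = solve-∀
  collect : ∀ n → 30 * n + (n + n) ≡ 32 * n
  collect = solve-∀
  s<n : s < n
  s<n = m*m<n*n⇒m<n (begin-strict
    s * s       ≤⟨ s²≤30n ⟩
    30 * n      <⟨ m<n+m (30 * n) (≤-trans (s≤s z≤n) 31≤n) ⟩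
    31 * n      ≤⟨ *-monoˡ-≤ n 31≤n ⟩
    n * n       ∎)

≤primesBetween-n≥127 : ∀ {n k} → SqrtGapsBelowHalf 32 → 127 ≤ n → 2 * (k * k) ≤ n → k ≤ primesBetween n
≤primesBetween-n≥127 {n} {k} gaps 127≤n 2k²≤n =
  let q , q≤n , isQ            = primeCount-attains n (≤-trans (s≤s z≤n) 31≤πn) ≤-refl
      t , t²≤16n , 16n<[t+1]²  = ⌊√ 16 * n ⌋
      P , isP , 16P<[t+1+2k]² = nthPrime-sqrt-growth {Y = suc t} (sqrtGapsBelowHalf-mono (s≤s 31≤πn) gaps) isQ
                                   (≤-<-trans (*-monoʳ-≤ 16 q≤n) 16n<[t+1]²) k
      [t+1+2k]²≤32n           = [s+1]²≤32n {n} {t + 2 * k} ([t+2k]²≤30n {n} {t} {k} t²≤16n 2k²≤n) 31≤n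
      16P<16[2n]              = <-≤-trans 16P<[t+1+2k]² (≤-trans [t+1+2k]²≤32n (≤-reflexive (*-assoc 16 2 n)))
  in nthPrime<2n⇒≤primesBetween {n} isP (*-cancelˡ-< 16 P (2 * n) 16P<16[2n])
  where
  31≤n : 31 ≤ n
  31≤n = ≤-trans (m≤m+n 31 96) 127≤n
  -- π(127) = 31 by evaluation
  31≤πn : 31 ≤ primeCount n
  31≤πn = primeCount-mono {127} 127≤n

-- The number of primes in (b, 2a); these lie in (n, 2n) whenever a ≤ n ≤ b.
windowPrimes : ℕ → ℕ → ℕ
windowPrimes a b = primeCount (a + (a ∸ 1)) ∸ primeCount b

windowPrimes≤primesBetween : ∀ {a b n} → a ≤ n → n ≤ b → windowPrimes a b ≤ primesBetween n
windowPrimes≤primesBetween {n = n} a≤n n≤b =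
  subst (_ ≤_) (sym (primesBetween≡ n))
    (∸-mono (primeCount-mono (+-mono-≤ a≤n (∸-monoˡ-≤ 1 a≤n))) (primeCount-mono n≤b))

Block : ℕ → ℕ → Set
Block a b = b < 2 * (suc (windowPrimes a b) * suc (windowPrimes a b))

block⇒≤primesBetween : ∀ {a b n k} → Block a b → a ≤ n → n ≤ b →
                       2 * (k * k) ≤ n → k ≤ primesBetween n
block⇒≤primesBetween block a≤n n≤b 2k²≤n = ≤-trans
  (s≤s⁻¹ (m*m<n*n⇒m<n (*-cancelˡ-< 2 _ _ (≤-<-trans 2k²≤n (≤-<-trans n≤b block)))))
  (windowPrimes≤primesBetween a≤n n≤b)

-- Blocks [a, b₁], [b₁ + 1, b₂], … whose right ends are listed, covering [a, N].
Covers : ℕ → List ℕ → ℕ → Set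
Covers a []       N = N < a
Covers a (b ∷ bs) N = Block a b × Covers (suc b) bs N

covers? : ∀ a bs N → Dec (Covers a bs N)
covers? a []       N = N <? a
covers? a (b ∷ bs) N = (b <? _) ×-dec covers? (suc b) bs N

covers⇒≤primesBetween : ∀ {a bs N n k} → Covers a bs N → a ≤ n → n ≤ N →
                        2 * (k * k) ≤ n → k ≤ primesBetween n
covers⇒≤primesBetween {bs = []}     N<a         a≤n n≤N _ = contradiction (≤-trans a≤n n≤N) (<⇒≱ N<a)
covers⇒≤primesBetween {bs = b ∷ bs} {n = n} (block , rest) a≤n n≤N 2k²≤n with n ≤? b
... | yes n≤b = block⇒≤primesBetween block a≤n n≤b 2k²≤n
... | no  n≰b = covers⇒≤primesBetween rest (≰⇒> n≰b) n≤N 2k²≤n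

≤primesBetween-n≤126 : ∀ {n k} → 2 ≤ n → n ≤ 126 → 2 * (k * k) ≤ n → k ≤ primesBetween n
≤primesBetween-n≤126 = covers⇒≤primesBetween (from-yes (covers? 2 blockEnds 126))
  where
  blockEnds : List ℕ
  blockEnds = 2 ∷ 4 ∷ 6 ∷ 10 ∷ 16 ∷ 22 ∷ 31 ∷ 46 ∷ 70 ∷ 106 ∷ 126 ∷ []

corollary2 :
    ((m p q : ℕ) → 32 ≤ m → IsNthPrime m p → IsNthPrime (m ∸ 1) q →
      (4 * (p ∸ q) ∸ 1) ^ 2 < 16 * q) →
    (n : ℕ) → 2 ≤ n → (k : ℕ) → 2 * (k * k) ≤ n → k ≤ primesBetween n
corollary2 gaps n 2≤n k 2k²≤n with n ≤? 126
... | yes n≤126 = ≤primesBetween-n≤126 2≤n n≤126 2k²≤n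
... | no  n≰126 = ≤primesBetween-n≥127 gaps (≰⇒> n≰126) 2k²≤n
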